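{- For every $n\ge 1$, Snort played on the (initially uncoloured, untinted) graph $T_{n,3}$ is a first player win.
   Context: Snort is a two-player game (players Left and Right) played on a finite simple graph. The players alternately colour a previously uncoloured vertex, Left in blue and Right in red, subject to the rule that no two adjacent vertices may receive opposite colours. Normal play: a player who cannot move on their turn loses. A game is a "first player win" if the player who moves first has a winning strategy, regardless of whether that player is Left or Right. $T_{n,m}$ is the graph with vertex set $\{(i,j): 1\le i\le n,\ 1\le j\le m\}$ and edges $(i,j)\sim(i+1,j)$ for $1\le i\le n-1$, $1\le j\le m$; $(i,j)\sim(i,j+1)$ for $1\le i\le n$, $1\le j\le m-1$; and $(i,j)\sim(i+1,j+1)$ for $1\le i\le n-1$, $1\le j\le m-1$. -}

module Defs where

open import Data.Nat using (ℕ; suc)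
open import Data.Fin using (Fin; toℕ)
open import Data.Product using (_×_; _,_)
open import Data.Sum using (_⊎_)
open import Relation.Binary.PropositionalEquality using (_≡_; _≢_)
open import Relation.Binary.Definitions using (DecidableEquality)
open import Relation.Nullary using (yes; no)

data Player : Set where
  Left Right : Player

opponent : Player → Player
opponent Left  = Right
opponent Right = Left

-- A vertex is uncoloured, or coloured by a player (Left = blue, Right = red).
data State : Set where
  uncoloured : State
  colouredBy : Player → State

module Snort {V : Set} (_≟_ : DecidableEquality V) (Adj : V → V → Set) where

  Position : Set
  Position = V → State

  start : Position
  start _ = uncoloured

  Legal : Player → Position → V → Set
  Legal p s v = (s v ≡ uncoloured) × (∀ u → Adj u v → s u ≢ colouredBy (opponent p))

  play : Position → V → Player → Position
  play s v p u with u ≟ v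
  ... | yes _ = colouredBy p
  ... | no  _ = s u

  -- Normal play: a player with no legal move loses.
  data Wins  : Player → Position → Set
  data Loses : Player → Position → Set

  data Wins where
    move : ∀ {p s} (v : V) → Legal p s v → Loses (opponent p) (play s v p) → Wins p s

  data Loses where
    allMoves : ∀ {p s} → (∀ v → Legal p s v → Wins (opponent p) (play s v p)) → Loses p s

  FirstPlayerWin : Set
  FirstPlayerWin = Wins Left start × Wins Right start

-- The graph T_{n,m}: vertices (i,j), 0-indexed here via Fin.
TVertex : ℕ → ℕ → Set
TVertex n m = Fin n × Fin m

TEdge : ∀ {n m} → TVertex n m → TVertex n m → Set
TEdge (i , j) (i' , j') =
  (toℕ i' ≡ suc (toℕ i) × toℕ j' ≡ toℕ j)
  ⊎ (toℕ i' ≡ toℕ i × toℕ j' ≡ suc (toℕ j))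
  ⊎ (toℕ i' ≡ suc (toℕ i) × toℕ j' ≡ suc (toℕ j))

TAdj : ∀ {n m} → TVertex n m → TVertex n m → Set
TAdj u v = TEdge u v ⊎ TEdge v u

module Submission where

-- The first player colours the centre of T_{n,3} (the middle vertex of the
-- middle column, or for even n the lower of its two middle vertices) and
-- then answers each move v by the opposite colour on the image of v under the
-- half-turn rotation.  The rotation is a graph automorphism and no vertex
-- away from the centre is equal or adjacent to its image, so the answer is
-- always legal and the second player is the one who runs out of moves.

open import Defs
open import Data.Nat using (ℕ; suc; _+_; _≤_; _<_; _≥_; z≤n; s≤s; ⌊_/2⌋; ⌈_/2⌉)
open import Data.Nat.Induction using (<-wellFounded)
open import Data.Nat.Properties
  using (≤-refl; +-mono-≤; +-mono-≤-<; ≤-<-trans; +-suc; +-cancelˡ-≡; m+[n∸m]≡n;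
         ⌊n/2⌋≤n; ⌊n/2⌋+⌈n/2⌉≡n; n≡⌊n+n/2⌋; n≡⌈n+n/2⌉)
open import Data.Fin using (Fin; toℕ; opposite; fromℕ<) renaming (zero to fzero; suc to fsuc)
open import Data.Fin.Properties
  using (_≟_; toℕ-injective; toℕ-fromℕ<; toℕ≤pred[n]; opposite-prop; opposite-involutive)
open import Data.List using (List; []; _∷_; allFin; cartesianProduct)
open import Data.List.Membership.Propositional using (_∈_)
open import Data.List.Membership.Propositional.Properties using (∈-allFin; ∈-cartesianProduct⁺)
open import Data.List.Relation.Unary.Any using (here; there)
open import Data.Product using (_×_; _,_; proj₁; proj₂)
open import Data.Product.Properties using (≡-dec)
open import Data.Sum using (_⊎_; inj₁; inj₂; [_,_])
import Data.Sum as Sum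
open import Data.Empty using (⊥-elim)
open import Function using (_∘_; _on_)
open import Induction.WellFounded using (Acc; acc)
open import Relation.Binary.Construct.On using (wellFounded)
open import Relation.Binary.Definitions using (DecidableEquality)
open import Relation.Binary.PropositionalEquality
  using (_≡_; _≢_; refl; sym; trans; cong; cong₂; subst; module ≡-Reasoning)
open import Relation.Nullary using (Dec; yes; no; ¬_)

opponent-involutive : ∀ p → opponent (opponent p) ≡ p
opponent-involutive Left  = refl
opponent-involutive Right = refl

swapColour : State → State
swapColour uncoloured     = uncoloured
swapColour (colouredBy p) = colouredBy (opponent p)

colouredBy≢uncoloured : ∀ {p} → colouredBy p ≢ uncoloured
colouredBy≢uncoloured ()

colouredBy-≢-opponent : ∀ p → colouredBy p ≢ colouredBy (opponent p)
colouredBy-≢-opponent Left  ()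
colouredBy-≢-opponent Right ()

isUncoloured : State → ℕ
isUncoloured uncoloured     = 1
isUncoloured (colouredBy _) = 0

module MirrorStrategy
  {V : Set} (_≟ᵥ_ : DecidableEquality V) (Adj : V → V → Set)
  (vertices : List V) (∈-vertices : ∀ v → v ∈ vertices)
  (σ : V → V) (σ-involutive : ∀ v → σ (σ v) ≡ v)
  (σ-Adj : ∀ {u v} → Adj u v → Adj (σ u) (σ v))
  (c : V) (c-near-σc : c ≡ σ c ⊎ Adj c (σ c))
  (near-σ⇒central : ∀ v → v ≡ σ v ⊎ Adj v (σ v) → v ≡ c ⊎ v ≡ σ c)
  where

  open Snort _≟ᵥ_ Adj

  σ-transpose : ∀ {u v} → σ u ≡ v → u ≡ σ v
  σ-transpose {u} σu≡v = trans (sym (σ-involutive u)) (cong σ σu≡v)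

  σ-injective : ∀ {u v} → σ u ≡ σ v → u ≡ v
  σ-injective {v = v} σu≡σv = trans (σ-transpose σu≡σv) (σ-involutive v)

  play-≡ : ∀ s v p → play s v p v ≡ colouredBy p
  play-≡ s v p with v ≟ᵥ v
  ... | yes _  = refl
  ... | no v≢v = ⊥-elim (v≢v refl)

  play-≢ : ∀ s v p {u} → u ≢ v → play s v p u ≡ s u
  play-≢ s v p {u} u≢v with u ≟ᵥ v
  ... | yes u≡v = ⊥-elim (u≢v u≡v)
  ... | no _    = refl

  #uncoloured : List V → Position → ℕ
  #uncoloured []       s = 0
  #uncoloured (u ∷ us) s = isUncoloured (s u) + #uncoloured us s

  isUncoloured-play : ∀ s v p u → isUncoloured (play s v p u) ≤ isUncoloured (s u)
  isUncoloured-play s v p u with u ≟ᵥ v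
  ... | yes _ = z≤n
  ... | no _  = ≤-refl

  #uncoloured-play-≤ : ∀ us s v p → #uncoloured us (play s v p) ≤ #uncoloured us s
  #uncoloured-play-≤ []       s v p = z≤n
  #uncoloured-play-≤ (u ∷ us) s v p =
    +-mono-≤ (isUncoloured-play s v p u) (#uncoloured-play-≤ us s v p)

  #uncoloured-play-< : ∀ {us s v} p → s v ≡ uncoloured → v ∈ us →
                       #uncoloured us (play s v p) < #uncoloured us s
  #uncoloured-play-< {u ∷ us} {s} p sv≡u (here refl) rewrite play-≡ s u p | sv≡u =
    s≤s (#uncoloured-play-≤ us s u p)
  #uncoloured-play-< {u ∷ us} {s} {v} p sv≡u (there v∈us) =
    +-mono-≤-< (isUncoloured-play s v p u) (#uncoloured-play-< p sv≡u v∈us)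

  _⊏_ : Position → Position → Set
  _⊏_ = _<_ on #uncoloured vertices

  SymmetricOffCentre : Position → Set
  SymmetricOffCentre s = ∀ w → w ≢ c → w ≢ σ c → s (σ w) ≡ swapColour (s w)

  -- p owns the centre; its opponent is to move
  Mirrored : Player → Position → Set
  Mirrored p s = s c ≡ colouredBy p × s (σ c) ≢ colouredBy (opponent p) × SymmetricOffCentre s

  off-centre⇒moved : ∀ {v} → v ≢ c → v ≢ σ c → σ v ≢ v
  off-centre⇒moved v≢c v≢σc σv≡v = [ v≢c , v≢σc ] (near-σ⇒central _ (inj₁ (sym σv≡v)))

  off-centre⇒¬Adj-σ : ∀ {v} → v ≢ c → v ≢ σ c → ¬ Adj v (σ v)
  off-centre⇒¬Adj-σ v≢c v≢σc a = [ v≢c , v≢σc ] (near-σ⇒central _ (inj₂ a))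

  legal-off-centre : ∀ {p s v} → Mirrored p s → Legal (opponent p) s v → v ≢ c × v ≢ σ c
  legal-off-centre {p} {s} {v} (sc≡p , _ , _) (sv≡u , v-legal) = v≢c , v≢σc
    where
    v≢c : v ≢ c
    v≢c refl = colouredBy≢uncoloured (trans (sym sc≡p) sv≡u)
    v≢σc : v ≢ σ c
    v≢σc refl = [ c≢σc , ¬Adj-c-σc ] c-near-σc
      where
      c≢σc : c ≢ σ c
      c≢σc c≡σc = colouredBy≢uncoloured (trans (sym sc≡p) (trans (cong s c≡σc) sv≡u))
      ¬Adj-c-σc : ¬ Adj c (σ c)
      ¬Adj-c-σc a = v-legal c a (trans sc≡p (cong colouredBy (sym (opponent-involutive p))))

  mirror-legal : ∀ {p s v} → Mirrored p s → Legal (opponent p) s v →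
                 Legal p (play s v (opponent p)) (σ v)
  mirror-legal {p} {s} {v} m@(sc≡p , sσc≢q , symmetric) (sv≡u , v-legal) =
    trans (play-≢ s v q σv≢v) (trans (symmetric v v≢c v≢σc) (cong swapColour sv≡u)) ,
    σv-unblocked
    where
    q = opponent p
    v≢c = proj₁ (legal-off-centre m (sv≡u , v-legal))
    v≢σc = proj₂ (legal-off-centre m (sv≡u , v-legal))
    σv≢v = off-centre⇒moved v≢c v≢σc
    -- a q-coloured neighbour u of σ v would make σ u a p-coloured neighbour of v
    σv-unblocked : ∀ u → Adj u (σ v) → play s v q u ≢ colouredBy q
    σv-unblocked u a su≡q with u ≟ᵥ v
    ... | yes refl = off-centre⇒¬Adj-σ v≢c v≢σc a
    ... | no u≢v = v-legal (σ u) (subst (Adj (σ u)) (σ-involutive v) (σ-Adj a))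
                     (trans (symmetric u u≢c u≢σc) (cong swapColour su≡q))
      where
      u≢c : u ≢ c
      u≢c refl = colouredBy-≢-opponent p (trans (sym sc≡p) su≡q)
      u≢σc : u ≢ σ c
      u≢σc refl = sσc≢q su≡q

  mirrored-reply : ∀ {p s v} → Mirrored p s → v ≢ c → v ≢ σ c →
                   Mirrored p (play (play s v (opponent p)) (σ v) p)
  mirrored-reply {p} {s} {v} (sc≡p , sσc≢q , symmetric) v≢c v≢σc =
    trans (untouched c≢v c≢σv) sc≡p ,
    (λ e → sσc≢q (trans (sym (untouched (v≢σc ∘ sym) (v≢c ∘ sym ∘ σ-injective))) e)) ,
    symmetric″
    where
    q = opponent p
    s″ = play (play s v q) (σ v) p
    σv≢v = off-centre⇒moved v≢c v≢σc
    c≢v = v≢c ∘ sym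
    c≢σv : c ≢ σ v
    c≢σv = v≢σc ∘ σ-transpose ∘ sym
    untouched : ∀ {u} → u ≢ v → u ≢ σ v → s″ u ≡ s u
    untouched u≢v u≢σv = trans (play-≢ _ (σ v) p u≢σv) (play-≢ s v q u≢v)
    s″v≡q : s″ v ≡ colouredBy q
    s″v≡q = trans (play-≢ _ (σ v) p (σv≢v ∘ sym)) (play-≡ s v q)
    s″σv≡p : s″ (σ v) ≡ colouredBy p
    s″σv≡p = play-≡ _ (σ v) p
    symmetric-at : ∀ {w} → w ≡ v → s″ (σ w) ≡ swapColour (s″ w)
    symmetric-at refl = trans s″σv≡p
      (sym (trans (cong swapColour s″v≡q) (cong colouredBy (opponent-involutive p))))
    symmetric-at-σ : ∀ {w} → w ≡ σ v → s″ (σ w) ≡ swapColour (s″ w)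
    symmetric-at-σ refl = trans (cong s″ (σ-involutive v))
      (trans s″v≡q (sym (cong swapColour s″σv≡p)))
    symmetric″ : SymmetricOffCentre s″
    symmetric″ w w≢c w≢σc = by-cases (w ≟ᵥ v) (w ≟ᵥ σ v)
      where
      by-cases : Dec (w ≡ v) → Dec (w ≡ σ v) → s″ (σ w) ≡ swapColour (s″ w)
      by-cases (yes w≡v) _          = symmetric-at w≡v
      by-cases (no _)    (yes w≡σv) = symmetric-at-σ w≡σv
      by-cases (no w≢v)  (no w≢σv)  =
        trans (untouched (w≢σv ∘ σ-transpose) (w≢v ∘ σ-injective))
              (trans (symmetric w w≢c w≢σc) (cong swapColour (sym (untouched w≢v w≢σv))))

  mirrored-start : ∀ p → Mirrored p (play start c p)
  mirrored-start p = play-≡ start c p , not-opponent (σ c) , symmetric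
    where
    not-opponent : ∀ u → play start c p u ≢ colouredBy (opponent p)
    not-opponent u with u ≟ᵥ c
    ... | yes _ = colouredBy-≢-opponent p
    ... | no _  = λ ()
    symmetric : SymmetricOffCentre (play start c p)
    symmetric w w≢c w≢σc =
      trans (play-≢ start c p (w≢σc ∘ σ-transpose)) (cong swapColour (sym (play-≢ start c p w≢c)))

  mirrored⇒opponent-loses : ∀ {p s} → Acc _⊏_ s → Mirrored p s → Loses (opponent p) s
  mirrored⇒opponent-loses {p} {s} (acc smaller) m = allMoves answer
    where
    answer : ∀ v → Legal (opponent p) s v → Wins (opponent (opponent p)) (play s v (opponent p))
    answer v legal@(sv≡u , _) = subst (λ r → Wins r (play s v (opponent p)))
      (sym (opponent-involutive p))
      (move (σ v) (mirror-legal m legal)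
        (mirrored⇒opponent-loses (smaller shorter) (mirrored-reply m v≢c v≢σc)))
      where
      v≢c = proj₁ (legal-off-centre m legal)
      v≢σc = proj₂ (legal-off-centre m legal)
      shorter : play (play s v (opponent p)) (σ v) p ⊏ s
      shorter = ≤-<-trans (#uncoloured-play-≤ vertices _ (σ v) p)
                          (#uncoloured-play-< (opponent p) sv≡u (∈-vertices v))

  first-player-wins : ∀ p → Wins p start
  first-player-wins p = move c (refl , λ _ _ ())
    (mirrored⇒opponent-loses (wellFounded (#uncoloured vertices) <-wellFounded _) (mirrored-start p))

  firstPlayerWin : FirstPlayerWin
  firstPlayerWin = first-player-wins Left , first-player-wins Right

toℕ+toℕ-opposite : ∀ {m} (i : Fin (suc m)) → toℕ i + toℕ (opposite i) ≡ m
toℕ+toℕ-opposite i = trans (cong (toℕ i +_) (opposite-prop i)) (m+[n∸m]≡n (toℕ≤pred[n] i))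

toℕ-opposite-suc : ∀ {m} {i j : Fin (suc m)} → toℕ j ≡ suc (toℕ i) →
                   toℕ (opposite i) ≡ suc (toℕ (opposite j))
toℕ-opposite-suc {m} {i} {j} j≡1+i = +-cancelˡ-≡ (toℕ i) _ _ (begin
  toℕ i + toℕ (opposite i)       ≡⟨ toℕ+toℕ-opposite i ⟩
  m                              ≡⟨ toℕ+toℕ-opposite j ⟨
  toℕ j + toℕ (opposite j)       ≡⟨ cong (_+ toℕ (opposite j)) j≡1+i ⟩
  suc (toℕ i) + toℕ (opposite j) ≡⟨ +-suc (toℕ i) (toℕ (opposite j)) ⟨
  toℕ i + suc (toℕ (opposite j)) ∎)
  where open ≡-Reasoning

toℕ-opposite-cong : ∀ {n} {i j : Fin n} → toℕ j ≡ toℕ i → toℕ (opposite i) ≡ toℕ (opposite j)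
toℕ-opposite-cong j≡i = cong (toℕ ∘ opposite) (toℕ-injective (sym j≡i))

rotate : ∀ {n m} → TVertex n m → TVertex n m
rotate (i , j) = opposite i , opposite j

rotate-involutive : ∀ {n m} (v : TVertex n m) → rotate (rotate v) ≡ v
rotate-involutive (i , j) = cong₂ _,_ (opposite-involutive i) (opposite-involutive j)

TEdge-rotate : ∀ {n m} {u v : TVertex (suc n) (suc m)} → TEdge u v → TEdge (rotate v) (rotate u)
TEdge-rotate (inj₁ (i , j))         = inj₁ (toℕ-opposite-suc i , toℕ-opposite-cong j)
TEdge-rotate (inj₂ (inj₁ (i , j))) = inj₂ (inj₁ (toℕ-opposite-cong i , toℕ-opposite-suc j))
TEdge-rotate (inj₂ (inj₂ (i , j))) = inj₂ (inj₂ (toℕ-opposite-suc i , toℕ-opposite-suc j))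

TAdj-rotate : ∀ {n m} {u v : TVertex (suc n) (suc m)} → TAdj u v → TAdj (rotate u) (rotate v)
TAdj-rotate = Sum.swap ∘ Sum.map TEdge-rotate TEdge-rotate

⌈n/2⌉≡⌊n/2⌋⊎1+⌊n/2⌋ : ∀ n → ⌈ n /2⌉ ≡ ⌊ n /2⌋ ⊎ ⌈ n /2⌉ ≡ suc ⌊ n /2⌋
⌈n/2⌉≡⌊n/2⌋⊎1+⌊n/2⌋ 0             = inj₁ refl
⌈n/2⌉≡⌊n/2⌋⊎1+⌊n/2⌋ 1             = inj₂ refl
⌈n/2⌉≡⌊n/2⌋⊎1+⌊n/2⌋ (suc (suc n)) = Sum.map (cong suc) (cong suc) (⌈n/2⌉≡⌊n/2⌋⊎1+⌊n/2⌋ n)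

≡⌊n/2⌋ : ∀ {a b n} → a + b ≡ n → b ≡ a ⊎ b ≡ suc a → a ≡ ⌊ n /2⌋
≡⌊n/2⌋ {a} refl (inj₁ refl) = n≡⌊n+n/2⌋ a
≡⌊n/2⌋ {a} refl (inj₂ refl) = trans (n≡⌈n+n/2⌉ a) (cong ⌊_/2⌋ (sym (+-suc a a)))

-- the lower of the (one or two) middle indices
IsMiddle : ∀ {m} → Fin (suc m) → Set
IsMiddle i = toℕ (opposite i) ≡ toℕ i ⊎ toℕ (opposite i) ≡ suc (toℕ i)

middle : ∀ m → Fin (suc m)
middle m = fromℕ< (s≤s (⌊n/2⌋≤n m))

toℕ-middle : ∀ m → toℕ (middle m) ≡ ⌊ m /2⌋
toℕ-middle m = toℕ-fromℕ< (s≤s (⌊n/2⌋≤n m))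

middle-isMiddle : ∀ m → IsMiddle (middle m)
middle-isMiddle m = Sum.map (λ e → trans opposite≡⌈m/2⌉ (trans e (sym (toℕ-middle m))))
                             (λ e → trans opposite≡⌈m/2⌉ (trans e (cong suc (sym (toℕ-middle m)))))
                             (⌈n/2⌉≡⌊n/2⌋⊎1+⌊n/2⌋ m)
  where
  opposite≡⌈m/2⌉ : toℕ (opposite (middle m)) ≡ ⌈ m /2⌉
  opposite≡⌈m/2⌉ = +-cancelˡ-≡ ⌊ m /2⌋ _ _
    (trans (cong (_+ toℕ (opposite (middle m))) (sym (toℕ-middle m)))
           (trans (toℕ+toℕ-opposite (middle m)) (sym (⌊n/2⌋+⌈n/2⌉≡n m))))

isMiddle⇒≡middle : ∀ {m} {i : Fin (suc m)} → IsMiddle i → i ≡ middle m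
isMiddle⇒≡middle {m} {i} mid = toℕ-injective
  (trans (≡⌊n/2⌋ (toℕ+toℕ-opposite i) mid) (sym (toℕ-middle m)))

middle-column : (j : Fin 3) → toℕ (opposite j) ≡ toℕ j → j ≡ fsuc fzero
middle-column fzero               ()
middle-column (fsuc fzero)        _  = refl
middle-column (fsuc (fsuc fzero)) ()

opposite-≢-suc : (j : Fin 3) → toℕ (opposite j) ≢ suc (toℕ j)
opposite-≢-suc fzero               ()
opposite-≢-suc (fsuc fzero)        ()
opposite-≢-suc (fsuc (fsuc fzero)) ()

centre : ∀ {m} → TVertex (suc m) 3
centre = middle _ , fsuc fzero

≡centre : ∀ {m} {i : Fin (suc m)} {j : Fin 3} → IsMiddle i → toℕ (opposite j) ≡ toℕ j →
          (i , j) ≡ centre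
≡centre mid j-mid = cong₂ _,_ (isMiddle⇒≡middle mid) (middle-column _ j-mid)

centre-near-rotate : ∀ {m} → centre {m} ≡ rotate centre ⊎ TAdj centre (rotate centre)
centre-near-rotate {m} with middle-isMiddle m
... | inj₁ e = inj₁ (cong (_, fsuc fzero) (toℕ-injective (sym e)))
... | inj₂ e = inj₂ (inj₁ (inj₁ (e , refl)))

fixed⇒centre : ∀ {m} (v : TVertex (suc m) 3) → v ≡ rotate v → v ≡ centre
fixed⇒centre (i , j) v≡rv =
  ≡centre (inj₁ (sym (cong (toℕ ∘ proj₁) v≡rv))) (sym (cong (toℕ ∘ proj₂) v≡rv))

edge-to-rotate⇒centre : ∀ {m} (v : TVertex (suc m) 3) → TEdge v (rotate v) → v ≡ centre
edge-to-rotate⇒centre (i , j) (inj₁ (i-mid , j-mid)) = ≡centre (inj₂ i-mid) j-mid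
edge-to-rotate⇒centre (i , j) (inj₂ (inj₁ (_ , j-suc))) = ⊥-elim (opposite-≢-suc j j-suc)
edge-to-rotate⇒centre (i , j) (inj₂ (inj₂ (_ , j-suc))) = ⊥-elim (opposite-≢-suc j j-suc)

near-rotate⇒central : ∀ {m} (v : TVertex (suc m) 3) → v ≡ rotate v ⊎ TAdj v (rotate v) →
                       v ≡ centre ⊎ v ≡ rotate centre
near-rotate⇒central v (inj₁ v≡rv)     = inj₁ (fixed⇒centre v v≡rv)
near-rotate⇒central v (inj₂ (inj₁ e)) = inj₁ (edge-to-rotate⇒centre v e)
near-rotate⇒central v (inj₂ (inj₂ e)) = inj₂ (begin
  v                 ≡⟨ rotate-involutive v ⟨
  rotate (rotate v) ≡⟨ cong rotate (edge-to-rotate⇒centre (rotate v) e′) ⟩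
  rotate centre     ∎)
  where
  open ≡-Reasoning
  e′ : TEdge (rotate v) (rotate (rotate v))
  e′ = subst (TEdge (rotate v)) (sym (rotate-involutive v)) e

TVertex-complete : ∀ {n m} (v : TVertex n m) → v ∈ cartesianProduct (allFin n) (allFin m)
TVertex-complete (i , j) = ∈-cartesianProduct⁺ (∈-allFin i) (∈-allFin j)

lemma3p1 : (n : ℕ) → n ≥ 1 →
    Snort.FirstPlayerWin {TVertex n 3} (≡-dec _≟_ _≟_) (TAdj {n} {3})
lemma3p1 (suc m) _ =
  MirrorStrategy.firstPlayerWin (≡-dec _≟_ _≟_) TAdj _ TVertex-complete
    rotate rotate-involutive TAdj-rotate centre centre-near-rotate near-rotate⇒central
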